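{- For every finite simple graph $G$, $\nu(G)\ge\frac{|G|-\alpha(G)+\delta(G)}{4}$.
   Context: $\nu(G)$ is the matching number of $G$ (maximum number of edges in a matching), $|G|$ the number of vertices, $\alpha(G)$ the independence number and $\delta(G)$ the minimum degree. -}

module Defs where

open import Data.Nat using (ℕ; zero; suc; _⊓_)
open import Data.Bool using (Bool; true; false; if_then_else_)
open import Data.Fin using (Fin)
open import Data.Fin.Subset using (Subset; _∈_; ∣_∣)
open import Data.List using (List; []; _∷_; map; foldr; length; concatMap)
open import Data.Nat.ListAction using (sum)
open import Data.List.Base using (allFin)
open import Data.List.Relation.Unary.All using (All)
open import Data.List.Relation.Unary.Unique.Propositional using (Unique)
open import Data.Product using (_×_; _,_; Σ; proj₁; proj₂)
open import Relation.Binary.PropositionalEquality using (_≡_)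

record Graph (n : ℕ) : Set where
  field
    adj    : Fin n → Fin n → Bool
    sym    : ∀ u v → adj u v ≡ adj v u
    irrefl : ∀ v → adj v v ≡ false
open Graph public

-- |G| is n.

degree : ∀ {n} → Graph n → Fin n → ℕ
degree {n} G u = sum (map (λ v → if adj G u v then 1 else 0) (allFin n))

-- δ(G): minimum degree (convention δ = 0 for the empty graph)
minDegree : ∀ {n} → Graph n → ℕ
minDegree {zero}  G = 0
minDegree {suc n} G =
  foldr (λ v m → degree G v ⊓ m) (degree G Fin.zero) (allFin (suc n))

IsIndependent : ∀ {n} → Graph n → Subset n → Set
IsIndependent G S = ∀ u v → u ∈ S → v ∈ S → adj G u v ≡ false

IsIndependenceNumber : ∀ {n} → Graph n → ℕ → Set
IsIndependenceNumber {n} G a =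
  Σ (Subset n) (λ S → IsIndependent G S × ∣ S ∣ ≡ a)
  × (∀ (S : Subset n) → IsIndependent G S → ∣ S ∣ Data.Nat.≤ a)

IsMatching : ∀ {n} → Graph n → List (Fin n × Fin n) → Set
IsMatching G M =
  All (λ e → adj G (proj₁ e) (proj₂ e) ≡ true) M
  × Unique (concatMap (λ e → proj₁ e ∷ proj₂ e ∷ []) M)

IsMatchingNumber : ∀ {n} → Graph n → ℕ → Set
IsMatchingNumber {n} G k =
  Σ (List (Fin n × Fin n)) (λ M → IsMatching G M × length M ≡ k)
  × (∀ (M : List (Fin n × Fin n)) → IsMatching G M → length M Data.Nat.≤ k)

-- Let M be a maximum matching and C the set of its 2ν endpoints. By maximality no edge
-- joins two vertices outside C, so the complement of C is independent and n − 2ν ≤ α.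
-- The same fact bounds the degree of a vertex outside C (or of any vertex, if C is
-- everything) by ∣ C ∣, so δ ≤ 2ν. Adding the two bounds gives n + δ ≤ 4ν + α.
module Submission where

open import Defs hiding (sym)
open import Data.Nat using (ℕ; zero; suc; _+_; _*_; _⊓_; _≤_; z≤n; s≤s)
open import Data.Nat.Properties
  using (module ≤-Reasoning; ≤-reflexive; ≤-trans; +-mono-≤; +-monoʳ-≤; +-suc; *-suc;
         m⊓n≤m; m⊓n≤n; m+[n∸m]≡n; n≮n)
open import Data.Nat.ListAction using (sum)
open import Data.Nat.Tactic.RingSolver using (solve-∀)
open import Data.Bool using (Bool; true; false; if_then_else_)
open import Data.Fin using (Fin)
open import Data.Fin.Subset using (Subset; _∈_; _∉_; _⊆_; ∣_∣; ∁; _∪_; ⊥; ⁅_⁆; inside; outside)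
open import Data.Fin.Subset.Properties
  using (∣p∣≤n; ∣⊥∣≡0; ∣p∣≤∣x∷p∣; ∣⁅x⁆∣≡1; ∣∁p∣≡n∸∣p∣; p⊆q⇒∣p∣≤∣q∣; x∈⁅x⁆; x∈p∪q⁺;
         x∈∁p⇒x∉p; x∉∁p⇒x∈p; nonempty?)
open import Data.Vec using ([]; _∷_; tabulate)
open import Data.Vec.Properties using (lookup∘tabulate; []=⇒lookup)
open import Data.List using (List; []; _∷_; foldr; length; concatMap)
import Data.List as List
open import Data.List.Properties using (map-tabulate)
open import Data.List.Membership.Propositional using () renaming (_∈_ to _∈ˡ_)
open import Data.List.Membership.Propositional.Properties using (∈-allFin)
open import Data.List.Relation.Unary.Any using (here; there)
open import Data.List.Relation.Unary.All using (All; _∷_)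
open import Data.List.Relation.Unary.All.Properties using (¬Any⇒All¬)
open import Data.List.Relation.Unary.AllPairs using (_∷_)
open import Data.Empty using (⊥-elim)
open import Data.Product using (_×_; _,_; proj₁; proj₂)
open import Data.Sum using (inj₁; inj₂)
open import Function using (_∘_)
open import Relation.Nullary using (yes; no)
open import Relation.Binary.PropositionalEquality using (_≡_; _≢_; refl; sym; trans; cong)

∣p∪q∣≤∣p∣+∣q∣ : ∀ {n} (p q : Subset n) → ∣ p ∪ q ∣ ≤ ∣ p ∣ + ∣ q ∣
∣p∪q∣≤∣p∣+∣q∣ []            []            = z≤n
∣p∪q∣≤∣p∣+∣q∣ (inside  ∷ p) (t       ∷ q) =
  s≤s (≤-trans (∣p∪q∣≤∣p∣+∣q∣ p q) (+-monoʳ-≤ ∣ p ∣ (∣p∣≤∣x∷p∣ t q)))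
∣p∪q∣≤∣p∣+∣q∣ (outside ∷ p) (inside  ∷ q) =
  ≤-trans (s≤s (∣p∪q∣≤∣p∣+∣q∣ p q)) (≤-reflexive (sym (+-suc ∣ p ∣ ∣ q ∣)))
∣p∪q∣≤∣p∣+∣q∣ (outside ∷ p) (outside ∷ q) = ∣p∪q∣≤∣p∣+∣q∣ p q

∣p∣+∣∁p∣≡n : ∀ {n} (p : Subset n) → ∣ p ∣ + ∣ ∁ p ∣ ≡ n
∣p∣+∣∁p∣≡n p = trans (cong (∣ p ∣ +_) (∣∁p∣≡n∸∣p∣ p)) (m+[n∸m]≡n (∣p∣≤n p))

toSubset : ∀ {n} → List (Fin n) → Subset n
toSubset []       = ⊥
toSubset (x ∷ xs) = ⁅ x ⁆ ∪ toSubset xs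

∈ˡ⇒∈toSubset : ∀ {n} {x : Fin n} {xs} → x ∈ˡ xs → x ∈ toSubset xs
∈ˡ⇒∈toSubset (here refl)  = x∈p∪q⁺ (inj₁ (x∈⁅x⁆ _))
∈ˡ⇒∈toSubset (there x∈xs) = x∈p∪q⁺ (inj₂ (∈ˡ⇒∈toSubset x∈xs))

∣toSubset∣≤length : ∀ {n} (xs : List (Fin n)) → ∣ toSubset xs ∣ ≤ length xs
∣toSubset∣≤length {n} []       = ≤-reflexive (∣⊥∣≡0 n)
∣toSubset∣≤length     (x ∷ xs) = ≤-trans (∣p∪q∣≤∣p∣+∣q∣ ⁅ x ⁆ (toSubset xs))
  (+-mono-≤ (≤-reflexive (∣⁅x⁆∣≡1 x)) (∣toSubset∣≤length xs))

neighbours : ∀ {n} → Graph n → Fin n → Subset n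
neighbours G u = tabulate (adj G u)

∈neighbours⇒adj : ∀ {n} (G : Graph n) {u v} → v ∈ neighbours G u → adj G u v ≡ true
∈neighbours⇒adj G {u} {v} v∈N = trans (sym (lookup∘tabulate (adj G u) v)) ([]=⇒lookup v∈N)

sum-indicator≡∣tabulate∣ : ∀ {n} (f : Fin n → Bool) →
  sum (List.tabulate (λ v → if f v then 1 else 0)) ≡ ∣ tabulate f ∣
sum-indicator≡∣tabulate∣ {zero}  f = refl
sum-indicator≡∣tabulate∣ {suc n} f with f Fin.zero
... | true  = cong suc (sum-indicator≡∣tabulate∣ (f ∘ Fin.suc))
... | false = sum-indicator≡∣tabulate∣ (f ∘ Fin.suc)

degree≡∣neighbours∣ : ∀ {n} (G : Graph n) u → degree G u ≡ ∣ neighbours G u ∣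
degree≡∣neighbours∣ G u =
  trans (cong sum (map-tabulate (λ v → v) (λ v → if adj G u v then 1 else 0)))
        (sum-indicator≡∣tabulate∣ (adj G u))

foldr-⊓-≤ : ∀ {A : Set} (f : A → ℕ) z {x} {xs : List A} → x ∈ˡ xs →
  foldr (λ y m → f y ⊓ m) z xs ≤ f x
foldr-⊓-≤ f z {xs = y ∷ _}  (here refl)  = m⊓n≤m (f y) _
foldr-⊓-≤ f z {xs = y ∷ ys} (there x∈ys) = ≤-trans (m⊓n≤n (f y) _) (foldr-⊓-≤ f z x∈ys)

minDegree≤degree : ∀ {n} (G : Graph n) u → minDegree G ≤ degree G u
minDegree≤degree {suc n} G u = foldr-⊓-≤ (degree G) _ (∈-allFin u)

degree≤∣p∣ : ∀ {n} (G : Graph n) {u} {p : Subset n} → neighbours G u ⊆ p → degree G u ≤ ∣ p ∣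
degree≤∣p∣ G {u} N⊆p = ≤-trans (≤-reflexive (degree≡∣neighbours∣ G u)) (p⊆q⇒∣p∣≤∣q∣ N⊆p)

true≢false : true ≢ false
true≢false ()

neighbours⊆cover : ∀ {n} (G : Graph n) {C : Subset n} → IsIndependent G (∁ C) →
  ∀ {u} → u ∈ ∁ C → neighbours G u ⊆ C
neighbours⊆cover G indep {u} u∈∁C {v} v∈N = x∉∁p⇒x∈p λ v∈∁C →
  true≢false (trans (sym (∈neighbours⇒adj G v∈N)) (indep u v u∈∁C v∈∁C))

minDegree≤∣cover∣ : ∀ {n} (G : Graph n) (C : Subset n) → IsIndependent G (∁ C) →
  minDegree G ≤ ∣ C ∣
minDegree≤∣cover∣ {zero}  G C indep = z≤n
minDegree≤∣cover∣ {suc n} G C indep with nonempty? (∁ C)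
... | yes (u , u∈∁C) =
  ≤-trans (minDegree≤degree G u) (degree≤∣p∣ G (neighbours⊆cover G indep u∈∁C))
... | no ∁C-empty    =
  ≤-trans (minDegree≤degree G Fin.zero)
          (degree≤∣p∣ G λ {v} _ → x∉∁p⇒x∈p λ v∈∁C → ∁C-empty (v , v∈∁C))

endpoints : ∀ {n} → List (Fin n × Fin n) → List (Fin n)
endpoints = concatMap (λ e → proj₁ e ∷ proj₂ e ∷ [])

length-endpoints : ∀ {n} (M : List (Fin n × Fin n)) → length (endpoints M) ≡ 2 * length M
length-endpoints []      = refl
length-endpoints (e ∷ M) =
  trans (cong (suc ∘ suc) (length-endpoints M)) (sym (*-suc 2 (length M)))

matched : ∀ {n} → List (Fin n × Fin n) → Subset n
matched M = toSubset (endpoints M)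

∣matched∣≤2*length : ∀ {n} (M : List (Fin n × Fin n)) → ∣ matched M ∣ ≤ 2 * length M
∣matched∣≤2*length M =
  ≤-trans (∣toSubset∣≤length (endpoints M)) (≤-reflexive (length-endpoints M))

∷-isMatching : ∀ {n} {G : Graph n} {M u v} → IsMatching G M → adj G u v ≡ true →
  u ∉ matched M → v ∉ matched M → IsMatching G ((u , v) ∷ M)
∷-isMatching {G = G} {M} {u} {v} (edges , unique) uv u∉M v∉M =
  uv ∷ edges , (u≢v ∷ ∉⇒All≢ u∉M) ∷ ∉⇒All≢ v∉M ∷ unique
  where
  u≢v : u ≢ v
  u≢v refl = true≢false (trans (sym uv) (irrefl G u))
  ∉⇒All≢ : ∀ {x} → x ∉ matched M → All (x ≢_) (endpoints M)
  ∉⇒All≢ x∉M = ¬Any⇒All¬ (endpoints M) (x∉M ∘ ∈ˡ⇒∈toSubset)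

unmatched-independent : ∀ {n} (G : Graph n) {M} → IsMatching G M →
  (∀ M′ → IsMatching G M′ → length M′ ≤ length M) → IsIndependent G (∁ (matched M))
unmatched-independent G {M} isM maximum u v u∈ v∈ with adj G u v in uv
... | false = refl
... | true  = ⊥-elim (n≮n (length M) (maximum _ longer))
  where
  longer : IsMatching G ((u , v) ∷ M)
  longer = ∷-isMatching {G = G} isM uv (x∈∁p⇒x∉p u∈) (x∈∁p⇒x∉p v∈)

corollary6p10 : ∀ (n : ℕ) (G : Graph n) (ν α : ℕ) →
    IsMatchingNumber G ν → IsIndependenceNumber G α →
    n + minDegree G ≤ 4 * ν + α
corollary6p10 n G _ α ((M , isM , refl) , maximum) (_ , maximumIndependent) = begin
  n + minDegree G            ≡⟨ cong (_+ minDegree G) (sym (∣p∣+∣∁p∣≡n C)) ⟩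
  ∣ C ∣ + ∣ ∁ C ∣ + minDegree G
    ≤⟨ +-mono-≤ (+-mono-≤ (∣matched∣≤2*length M) (maximumIndependent (∁ C) indep))
                (≤-trans (minDegree≤∣cover∣ G C indep) (∣matched∣≤2*length M)) ⟩
  2 * ν + α + 2 * ν          ≡⟨ regroup ν α ⟩
  4 * ν + α                  ∎
  where
  open ≤-Reasoning
  regroup : ∀ a b → 2 * a + b + 2 * a ≡ 4 * a + b
  regroup = solve-∀
  ν : ℕ
  ν = length M
  C : Subset n
  C = matched M
  indep : IsIndependent G (∁ C)
  indep = unmatched-independent G isM maximum
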